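{- Let $F$ be an alternating shape with $n$ pipes, $\omega\in\mathfrak S_n$ sortable on $F$, and $P\in\Sigma_F(\omega)$. Let $p<q$ and let $\pi'=UpqV$ and $\pi=UqpV$ (in one-line notation, $U,V$ words) so that $\pi'$ is covered by $\pi$ in the weak order, and suppose $\pi$ is a linear extension of the contact graph of $P$. Then: (i) if the contact graph of $P$ has no arc $q\to p$, then $\pi'$ is also a linear extension of the contact graph of $P$; (ii) otherwise, $\pi'$ is a linear extension of the contact graph of $P'$, where $P'$ is the pipe dream obtained from $P$ by flipping the northeastmost contact between pipes $q$ and $p$.
   Context: Grid cells are unit squares with corners in $\mathbb Z^2$, indexed by their lower-left corner. An alternating shape $F$ (with parameter $n\ge 2$) is a connected finite set of cells whose boundary splits into four paths: a starting path from $(0,0)$ made of $n$ unit steps, each south or east; a NW stair path from $(0,0)$ to $(t_F,t_F)$ with steps $(NE)^{t_F}$, $t_F\ge 0$; an ending path from $(t_F,t_F)$ made of $n$ unit steps, each south or east; and a SE stair path from the endpoint of the starting path to the endpoint of the ending path with steps $(EN)^{b}$, $b\ge0$; the ending path stays strictly north and east of the starting path. A pipe dream on $F$ fills each cell with either a cross (one pipe passing straight horizontally, one straight vertically) or a contact (one elbow joining the west side to the north side, called the NW elbow, and one joining the south side to the east side, called the SE elbow), so that the $n$ pipes entering through the $n$ unit steps of the starting path exit through the $n$ unit steps of the ending path. Pipes are labelled $1,\dots,n$ by their entry step, from northwest to southeast along the starting path; the exit permutation $\omega$ is given by: $\omega(i)$ is the pipe exiting through the $i$-th step of the ending path (counted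 from northwest to southeast). A pipe dream is reduced if any two pipes cross at most once. $\Pi_F(\omega)$ is the set of reduced pipe dreams on $F$ with exit permutation $\omega$; $\omega$ is sortable on $F$ if $\Pi_F(\omega)\neq\emptyset$. For $a<b$, $(a,b)$ is an inversion of $\omega$ if $\omega^{ -1}(b)<\omega^{ -1}(a)$ and a noninversion otherwise; the (right) weak order is $\omega_1\le\omega_2$ iff the inversion set of $\omega_1$ is contained in that of $\omega_2$. The contact graph of $P$ is the directed graph on $\{1,\dots,n\}$ with an arc $a\to b$ iff some contact cell of $P$ has pipe $a$ on its NW elbow and pipe $b$ on its SE elbow. The extended contact graph is obtained by adding all arcs $a\to b$ with $(a,b)$ a noninversion of $\omega$. $P$ is strongly acyclic if its extended contact graph is acyclic; $\Sigma_F(\omega)$ is the set of strongly acyclic pipe dreams in $\Pi_F(\omega)$. A permutation $\pi$ is a linear extension of a directed graph $G$ on $\{1,\dots,n\}$ if $\pi^{ -1}(a)<\pi^{ -1}(b)$ for every arc $a\to b$ of $G$. Flip: if the two pipes passing through a contact cell $c$ of a reduced pipe dream cross in some cell $x$, flipping $c$ replaces the contact in $c$ by a cross and the cross in $x$ by a contact. -}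

module Defs where

open import Data.Nat as ℕ using (ℕ; zero; suc)
open import Data.Integer as ℤ using (ℤ; +_; _+_; _-_)
open import Data.Fin as Fin using (Fin; toℕ)
open import Data.Fin.Permutation using (Permutation′; _⟨$⟩ʳ_; _⟨$⟩ˡ_)
open import Data.Product using (Σ; ∃; ∃-syntax; _×_; _,_; proj₁; proj₂)
open import Data.Product.Properties using (≡-dec)
open import Data.Sum using (_⊎_)
open import Data.List as List using (List; []; _∷_; _++_; take; concat; replicate)
open import Data.List.Membership.Propositional using (_∈_)
open import Data.Vec as Vec using (Vec)
open import Relation.Nullary using (¬_; yes; no)
open import Relation.Binary.PropositionalEquality using (_≡_)
open import Relation.Binary.Construct.Closure.ReflexiveTransitive using (Star)
open import Relation.Binary.Construct.Closure.Transitive using (TransClosure)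

-- Points of ℤ², cells (indexed by their lower-left corner), unit edges

Point : Set
Point = ℤ × ℤ

Cell : Set
Cell = ℤ × ℤ

xOf yOf : Point → ℤ
xOf = proj₁
yOf = proj₂

-- unit edges: H (x,y) is the segment (x,y)-(x+1,y); V (x,y) is (x,y)-(x,y+1)
data Edge : Set where
  H V : Point → Edge

data Dir : Set where
  N E S : Dir

data SEStep : Set where
  south east : SEStep

toDir : SEStep → Dir
toDir south = S
toDir east  = E

move : Point → Dir → Point
move (x , y) N = (x , y + + 1)
move (x , y) E = (x + + 1 , y)
move (x , y) S = (x , y - + 1)

walk : Point → List Dir → Point
walk p []       = p
walk p (d ∷ ds) = walk (move p d) ds

stepEdge : Point → Dir → Edge
stepEdge p       N = V p
stepEdge p       E = H p
stepEdge (x , y) S = V (x , y - + 1)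

pathEdges : Point → List Dir → List Edge
pathEdges p []       = []
pathEdges p (d ∷ ds) = stepEdge p d ∷ pathEdges (move p d) ds

nwStair : ℕ → List Dir
nwStair t = concat (replicate t (N ∷ E ∷ []))

seStair : ℕ → List Dir
seStair b = concat (replicate b (E ∷ N ∷ []))

seList : ∀ {n} → Vec SEStep n → List Dir
seList v = Vec.toList (Vec.map toDir v)

origin : Point
origin = (+ 0 , + 0)

diagPt : ℕ → Point
diagPt t = (+ t , + t)

Adj : Cell → Cell → Set
Adj (x , y) (x' , y') =
  (x' ≡ x + + 1 × y' ≡ y) ⊎ (x ≡ x' + + 1 × y ≡ y') ⊎
  (y' ≡ y + + 1 × x' ≡ x) ⊎ (y ≡ y' + + 1 × x ≡ x')

side₁ side₂ : Edge → Cell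
side₁ (H (x , y)) = (x , y)
side₁ (V (x , y)) = (x , y)
side₂ (H (x , y)) = (x , y - + 1)
side₂ (V (x , y)) = (x - + 1 , y)

OnBoundary : List Cell → Edge → Set
OnBoundary C e = (side₁ e ∈ C × ¬ side₂ e ∈ C) ⊎ (¬ side₁ e ∈ C × side₂ e ∈ C)

Connected : List Cell → Set
Connected C = ∀ {c c'} → c ∈ C → c' ∈ C →
  Star (λ u v → u ∈ C × v ∈ C × Adj u v) c c'

record AltShape (n : ℕ) : Set where
  field
    cells  : List Cell
    t      : ℕ
    b      : ℕ
    start  : Vec SEStep n          -- starting path, from (0,0)
    end    : Vec SEStep n          -- ending path, from (t,t)
    n≥2    : 2 ℕ.≤ n
    closes : walk (walk origin (seList start)) (seStair b)
             ≡ walk (diagPt t) (seList end)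
    -- the ending path stays strictly north and east of the starting path
    -- (compared at the interior vertices; both k-th vertices lie on the
    -- same diagonal x - y = k)
    strict : ∀ k → 1 ℕ.≤ k → k ℕ.< n →
      (xOf (walk origin (take k (seList start))) ℤ.< xOf (walk (diagPt t) (take k (seList end))))
      × (yOf (walk origin (take k (seList start))) ℤ.< yOf (walk (diagPt t) (take k (seList end))))
    connected : Connected cells
    boundary→paths : ∀ e → OnBoundary cells e →
      e ∈ (pathEdges origin (seList start) ++ pathEdges origin (nwStair t)
           ++ pathEdges (diagPt t) (seList end)
           ++ pathEdges (walk origin (seList start)) (seStair b))
    paths→boundary : ∀ e →
      e ∈ (pathEdges origin (seList start) ++ pathEdges origin (nwStair t)
           ++ pathEdges (diagPt t) (seList end)
           ++ pathEdges (walk origin (seList start)) (seStair b)) →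
      OnBoundary cells e

open AltShape public

data Tile : Set where
  cross contact : Tile

-- a pipe dream on F: a tile for each cell (only the cells of F matter)
PipeDream : Set
PipeDream = Cell → Tile

data Side : Set where
  fromW fromS : Side

-- a pipe state: the cell it is entering and the side it enters through
State : Set
State = Cell × Side

next : PipeDream → State → State
next P (c@(x , y) , s) with P c | s
... | cross   | fromW = ((x + + 1 , y) , fromW)
... | cross   | fromS = ((x , y + + 1) , fromS)
... | contact | fromW = ((x , y + + 1) , fromS)   -- NW elbow: west → north
... | contact | fromS = ((x + + 1 , y) , fromW)   -- SE elbow: south → east

stepState : Point → SEStep → State
stepState p       east  = (p , fromS)
stepState (x , y) south = ((x , y - + 1) , fromW)

module _ {n : ℕ} (F : AltShape n) where

  -- pipe i enters through the i-th step of the starting path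
  entry : Fin n → State
  entry i = stepState (walk origin (take (toℕ i) (seList (start F)))) (Vec.lookup (start F) i)

  exitSt : Fin n → State
  exitSt i = stepState (walk (diagPt (t F)) (take (toℕ i) (seList (end F)))) (Vec.lookup (end F) i)

  data Trace (P : PipeDream) : State → State → Set where
    stop : ∀ {s} → ¬ (proj₁ s ∈ cells F) → Trace P s s
    go   : ∀ {s e} → proj₁ s ∈ cells F → Trace P (next P s) e → Trace P s e

  data Visits (P : PipeDream) : State → State → Set where
    here  : ∀ {s} → proj₁ s ∈ cells F → Visits P s s
    there : ∀ {s s'} → proj₁ s ∈ cells F → Visits P (next P s) s' → Visits P s s'

  PipeAt : PipeDream → Fin n → Cell → Side → Set
  PipeAt P a c d = Visits P (entry a) (c , d)

  HasExit : PipeDream → Permutation′ n → Set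
  HasExit P ω = ∀ i → Trace P (entry (ω ⟨$⟩ʳ i)) (exitSt i)

  CrossIn : PipeDream → Fin n → Fin n → Cell → Set
  CrossIn P a b c = P c ≡ cross ×
    ((PipeAt P a c fromW × PipeAt P b c fromS) ⊎ (PipeAt P b c fromW × PipeAt P a c fromS))

  Reduced : PipeDream → Set
  Reduced P = ∀ a b c c' → CrossIn P a b c → CrossIn P a b c' → c ≡ c'

  InΠ : Permutation′ n → PipeDream → Set
  InΠ ω P = Reduced P × HasExit P ω

  Sortable : Permutation′ n → Set
  Sortable ω = ∃[ P ] InΠ ω P

  ContactArc : PipeDream → Fin n → Fin n → Set
  ContactArc P a b = ∃[ c ] (P c ≡ contact × PipeAt P a c fromW × PipeAt P b c fromS)

  ExtArc : Permutation′ n → PipeDream → Fin n → Fin n → Set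
  ExtArc ω P a b = ContactArc P a b ⊎ (a Fin.< b × (ω ⟨$⟩ˡ a) Fin.< (ω ⟨$⟩ˡ b))

  InΣ : Permutation′ n → PipeDream → Set
  InΣ ω P = InΠ ω P × (∀ a → ¬ TransClosure (ExtArc ω P) a a)

  ContactBetween : PipeDream → Fin n → Fin n → Cell → Set
  ContactBetween P a b c = P c ≡ contact ×
    ((PipeAt P a c fromW × PipeAt P b c fromS) ⊎ (PipeAt P b c fromW × PipeAt P a c fromS))

  NEmostContact : PipeDream → Fin n → Fin n → Cell → Set
  NEmostContact P a b c = ContactBetween P a b c ×
    (∀ c' → ContactBetween P a b c' → (xOf c' ℤ.≤ xOf c) × (yOf c' ℤ.≤ yOf c))

-- flipping contact c (whose pipes cross in x): c becomes a cross, x a contact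
flip : PipeDream → Cell → Cell → PipeDream
flip P c x y with ≡-dec ℤ._≟_ ℤ._≟_ y c
... | yes _ = cross
... | no _ with ≡-dec ℤ._≟_ ℤ._≟_ y x
...   | yes _ = contact
...   | no _  = P y

LinExt : ∀ {n} → (Fin n → Fin n → Set) → Permutation′ n → Set
LinExt G π = ∀ a b → G a b → (π ⟨$⟩ˡ a) Fin.< (π ⟨$⟩ˡ b)

AdjSwap : ∀ {n} → Fin n → Fin n → Permutation′ n → Permutation′ n → Set
AdjSwap {n} p q π' π = ∃[ i ] ∃[ j ] (toℕ j ≡ suc (toℕ i) ×
  π' ⟨$⟩ʳ i ≡ p × π' ⟨$⟩ʳ j ≡ q × π ⟨$⟩ʳ i ≡ q × π ⟨$⟩ʳ j ≡ p ×
  (∀ k → ¬ k ≡ i → ¬ k ≡ j → π ⟨$⟩ʳ k ≡ π' ⟨$⟩ʳ k))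

-- Index the edge through which a pipe enters a cell by its antidiagonal x + y and its
-- offset along that antidiagonal.  A pipe advances one antidiagonal per step, and its offset
-- changes by at most one: it rises only through a cross entered from the west and falls only
-- through a cross entered from the south.  Pipe i enters with offset i, so a contact with q
-- on the northwest elbow and p < q on the southeast one comes after p and q have swapped
-- order, which by a discrete intermediate value argument happens at a cross x; since P is
-- reduced, x is the only cross of p and q.
--
-- Part (i) only compares positions in π and π'.  For part (ii) let c be the last contact of
-- q over p along q; as pipes move weakly northeast, c is the northeastmost one.  Flipping c
-- and x exchanges the names p and q exactly on the antidiagonals after x up to c, where all
-- contacts of q over p lie.  Hence each contact of the flipped pipe dream is a contact of P
-- with both pipes renamed or with neither, and since the positions in π' are those in π of
-- the renamed pipes, π' is a linear extension of its contact graph.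

module Submission where

open import Defs
open import Data.Nat using (ℕ)
open import Data.Fin as Fin using (Fin)
open import Data.Fin.Permutation using (Permutation′)
open import Data.Product using (∃-syntax; _×_)
open import Relation.Nullary using (¬_)

import Data.Integer.Properties as ℤ
open import Algebra.Properties.AbelianGroup ℤ.+-0-abelianGroup
  using (//-rightDividesˡ; //-rightDividesʳ; ∙-cancelˡ; ∙-cancelʳ; identityʳ-unique; inverseˡ-unique)
open import Data.Empty using (⊥; ⊥-elim)
open import Data.Fin using (toℕ)
import Data.Fin.Properties as Fin
open import Data.Fin.Permutation using (_⟨$⟩ˡ_; _⟨$⟩ʳ_; inverseˡ; inverseʳ)
open import Data.Fin.Permutation.Components using (transpose; transpose-inverse)
open import Data.Integer using (ℤ; +_; -[1+_]; _+_; _-_; -_; _≤_; _<_; +≤+; +<+; -≤+)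
open import Data.Integer.Tactic.RingSolver using (solve-∀)
open import Data.List using (take)
open import Data.List.Membership.Propositional using (_∈_)
open import Data.List.Membership.Propositional.Properties using (∈-++⁺ˡ)
open import Data.List.Relation.Unary.Any using (here; there)
open import Data.Nat as ℕ using (zero; suc; _∸_; z≤n; s≤s)
import Data.Nat.Properties as ℕ
open import Data.Product using (Σ-syntax; _,_; proj₁; proj₂; uncurry)
open import Data.Product.Properties using (≡-dec)
open import Data.Sum using (_⊎_; inj₁; inj₂)
open import Data.Vec as Vec using (Vec; _∷_)
open import Function using (_∘_)
open import Relation.Binary.Definitions using (tri<; tri≈; tri>)
open import Relation.Binary.PropositionalEquality
open import Relation.Nullary using (yes; no; Dec)
open import Relation.Nullary.Decidable using (dec-true; dec-false; _×-dec_)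

+-cancelʳ-≤ : ∀ c {a b} → a + c ≤ b + c → a ≤ b
+-cancelʳ-≤ c {a} {b} h =
  subst₂ _≤_ (//-rightDividesʳ c a) (//-rightDividesʳ c b) (ℤ.+-monoˡ-≤ (- c) h)

+-cancelˡ-≤ : ∀ c {a b} → c + a ≤ c + b → a ≤ b
+-cancelˡ-≤ c {a} {b} h = +-cancelʳ-≤ c (subst₂ _≤_ (ℤ.+-comm c a) (ℤ.+-comm c b) h)

<⇒+1≤ : ∀ {a b} → a < b → a + + 1 ≤ b
<⇒+1≤ {a} h = subst (_≤ _) (ℤ.+-comm (+ 1) a) (ℤ.i<j⇒suc[i]≤j h)

+1≤⇒< : ∀ {a b} → a + + 1 ≤ b → a < b
+1≤⇒< {a} h = ℤ.suc[i]≤j⇒i<j (subst (_≤ _) (ℤ.+-comm a (+ 1)) h)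

<+1⇒≤ : ∀ {a b} → a < b + + 1 → a ≤ b
<+1⇒≤ h = +-cancelʳ-≤ (+ 1) (<⇒+1≤ h)

<+1 : ∀ a → a < a + + 1
<+1 a = +1≤⇒< ℤ.≤-refl

+-cancel-shift : ∀ a b k d → b + + k ≡ a + + (k ℕ.+ d) → b ≡ a + + d
+-cancel-shift a b k d e = ∙-cancelʳ (+ k) b (a + + d) (trans e (shuffle a (+ k) (+ d)))
  where
  shuffle : ∀ a k d → a + (k + d) ≡ a + d + k
  shuffle = solve-∀

double-zero : ∀ z → z + z ≡ + 0 → z ≡ + 0
double-zero (+ zero)  _  = refl
double-zero (+ suc n) ()
double-zero -[1+ n ]  ()

double-not-odd : ∀ z → z + z ≢ -[1+ 0 ]
double-not-odd (+ n)     ()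
double-not-odd -[1+ n ] h with ℤ.-[1+-injective h
... | ()

-- Cells on a common antidiagonal are told apart by x - y, which moreover has the parity of x + y.
twice-Δx : ∀ x y x' y' → x + y ≡ x' + y' → (x - x') + (x - x') ≡ (x - y) - (x' - y')
twice-Δx x y x' y' s = begin
  (x - x') + (x - x')                  ≡⟨ split x y x' y' ⟩
  ((x + y) - (x' + y')) + δ             ≡⟨ cong (λ u → (u - (x' + y')) + δ) s ⟩
  ((x' + y') - (x' + y')) + δ           ≡⟨ cong (_+ δ) (ℤ.+-inverseʳ (x' + y')) ⟩
  + 0 + δ                              ≡⟨ ℤ.+-identityˡ δ ⟩
  δ                                    ∎
  where
  open ≡-Reasoning
  δ : ℤ
  δ = (x - y) - (x' - y')
  split : ∀ x y x' y' → (x - x') + (x - x') ≡ ((x + y) - (x' + y')) + ((x - y) - (x' - y'))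
  split = solve-∀

antidiagonal-injective : ∀ x y x' y' → x + y ≡ x' + y' → x - y ≡ x' - y' → x ≡ x' × y ≡ y'
antidiagonal-injective x y x' y' s d = x≡x' , ∙-cancelˡ x' y y' (subst (λ u → u + y ≡ x' + y') x≡x' s)
  where
  x≡x' : x ≡ x'
  x≡x' = ℤ.i-j≡0⇒i≡j x x' (double-zero (x - x') (trans (twice-Δx x y x' y' s) (ℤ.i≡j⇒i-j≡0 d)))

antidiagonal-parity : ∀ x y x' y' → x + y ≡ x' + y' → x - y ≢ x' - y' - + 1
antidiagonal-parity x y x' y' s d = double-not-odd (x - x') (begin
  (x - x') + (x - x')          ≡⟨ twice-Δx x y x' y' s ⟩
  (x - y) - (x' - y')          ≡⟨ cong (_- (x' - y')) d ⟩
  (x' - y' - + 1) - (x' - y')  ≡⟨ pred-minus (x' - y') ⟩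
  - + 1                        ∎)
  where
  open ≡-Reasoning
  pred-minus : ∀ a → (a - + 1) - a ≡ - + 1
  pred-minus = solve-∀

≤-cycle : ∀ {a b c d} → a ≤ b → b ≤ c → c ≤ d → d ≤ a → a ≡ b × b ≡ c × c ≡ d
≤-cycle a≤b b≤c c≤d d≤a =
  ℤ.≤-antisym a≤b (ℤ.≤-trans b≤c (ℤ.≤-trans c≤d d≤a)) ,
  ℤ.≤-antisym b≤c (ℤ.≤-trans c≤d (ℤ.≤-trans d≤a a≤b)) ,
  ℤ.≤-antisym c≤d (ℤ.≤-trans d≤a (ℤ.≤-trans a≤b b≤c))

cellLevel : Cell → ℤ
cellLevel (x , y) = x + y

level : State → ℤ
level s = cellLevel (proj₁ s)

-- Position of the entering edge along its antidiagonal, increasing towards the southeast;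
-- the west edge of a cell comes just before its south edge.
offset : State → ℤ
offset ((x , y) , fromW) = x - y - + 1
offset ((x , y) , fromS) = x - y

state-determined : ∀ {s s'} → level s ≡ level s' → offset s ≡ offset s' → s ≡ s'
state-determined {(x , y) , fromW} {(x' , y') , fromW} l o
  with antidiagonal-injective x y x' y' l (∙-cancelʳ (- + 1) (x - y) (x' - y') o)
... | refl , refl = refl
state-determined {(x , y) , fromS} {(x' , y') , fromS} l o with antidiagonal-injective x y x' y' l o
... | refl , refl = refl
state-determined {(x , y) , fromS} {(x' , y') , fromW} l o = ⊥-elim (antidiagonal-parity x y x' y' l o)
state-determined {(x , y) , fromW} {(x' , y') , fromS} l o = ⊥-elim (antidiagonal-parity x' y' x y (sym l) (sym o))

level-east : ∀ x y → (x + + 1) + y ≡ (x + y) + + 1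
level-east = solve-∀

level-north : ∀ x y → x + (y + + 1) ≡ (x + y) + + 1
level-north x y = sym (ℤ.+-assoc x y (+ 1))

level-next : ∀ P s → level (next P s) ≡ level s + + 1
level-next P ((x , y) , d) with P (x , y) | d
... | cross   | fromW = level-east x y
... | cross   | fromS = level-north x y
... | contact | fromW = level-north x y
... | contact | fromS = level-east x y

drift : Tile → Side → ℤ
drift cross   fromW = + 1
drift cross   fromS = - + 1
drift contact _     = + 0

offset-cross-west : ∀ x y → (x + + 1) - y - + 1 ≡ (x - y - + 1) + + 1
offset-cross-west = solve-∀

offset-cross-south : ∀ x y → x - (y + + 1) ≡ (x - y) + - + 1
offset-cross-south = solve-∀

offset-contact-west : ∀ x y → x - (y + + 1) ≡ (x - y - + 1) + + 0
offset-contact-west = solve-∀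

offset-contact-south : ∀ x y → (x + + 1) - y - + 1 ≡ (x - y) + + 0
offset-contact-south = solve-∀

offset-next : ∀ P s → offset (next P s) ≡ offset s + drift (P (proj₁ s)) (proj₂ s)
offset-next P ((x , y) , d) with P (x , y) | d
... | cross   | fromW = offset-cross-west x y
... | cross   | fromS = offset-cross-south x y
... | contact | fromW = offset-contact-west x y
... | contact | fromS = offset-contact-south x y

drift-≤ : ∀ t d → drift t d ≤ + 1
drift-≤ cross   fromW = ℤ.≤-refl
drift-≤ cross   fromS = -≤+
drift-≤ contact _     = +≤+ z≤n

drift-≥ : ∀ t d → - + 1 ≤ drift t d
drift-≥ cross   fromW = -≤+
drift-≥ cross   fromS = ℤ.≤-refl
drift-≥ contact _     = -≤+

drift-up : ∀ t d → drift t d ≡ + 1 → t ≡ cross × d ≡ fromW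
drift-up cross fromW _ = refl , refl

drift-down : ∀ t d → drift t d ≡ - + 1 → t ≡ cross × d ≡ fromS
drift-down cross fromS _ = refl , refl

_≟ˢ_ : (d d' : Side) → Dec (d ≡ d')
fromW ≟ˢ fromW = yes refl
fromW ≟ˢ fromS = no λ ()
fromS ≟ˢ fromW = no λ ()
fromS ≟ˢ fromS = yes refl

_≟ᵗ_ : (t t' : Tile) → Dec (t ≡ t')
cross   ≟ᵗ cross   = yes refl
cross   ≟ᵗ contact = no λ ()
contact ≟ᵗ cross   = no λ ()
contact ≟ᵗ contact = yes refl

_≟ᶜ_ : (c c' : Cell) → Dec (c ≡ c')
_≟ᶜ_ = ≡-dec ℤ._≟_ ℤ._≟_

_≟ˢᵗ_ : (s s' : State) → Dec (s ≡ s')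
_≟ˢᵗ_ = ≡-dec _≟ᶜ_ _≟ˢ_

prevCell : State → Cell
prevCell ((x , y) , fromW) = (x - + 1 , y)
prevCell ((x , y) , fromS) = (x , y - + 1)

prevSide : Tile → Side → Side
prevSide cross   d     = d
prevSide contact fromW = fromS
prevSide contact fromS = fromW

prev : PipeDream → State → State
prev P s = prevCell s , prevSide (P (prevCell s)) (proj₂ s)

prev-next : ∀ P s → prev P (next P s) ≡ s
prev-next P ((x , y) , d) with P (x , y) in t | d
... | cross   | fromW rewrite //-rightDividesʳ (+ 1) x | t = refl
... | cross   | fromS rewrite //-rightDividesʳ (+ 1) y | t = refl
... | contact | fromW rewrite //-rightDividesʳ (+ 1) y | t = refl
... | contact | fromS rewrite //-rightDividesʳ (+ 1) x | t = refl

next-injective : ∀ P {s s'} → next P s ≡ next P s' → s ≡ s'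
next-injective P {s} {s'} e = begin
  s                 ≡⟨ prev-next P s ⟨
  prev P (next P s)  ≡⟨ cong (prev P) e ⟩
  prev P (next P s') ≡⟨ prev-next P s' ⟩
  s'                ∎
  where open ≡-Reasoning

_≼_ : Cell → Cell → Set
(x , y) ≼ (x' , y') = x ≤ x' × y ≤ y'

≼-trans : ∀ {c c' c''} → c ≼ c' → c' ≼ c'' → c ≼ c''
≼-trans (x≤ , y≤) (x≤' , y≤') = ℤ.≤-trans x≤ x≤' , ℤ.≤-trans y≤ y≤'

cell-next-≽ : ∀ P s → proj₁ s ≼ proj₁ (next P s)
cell-next-≽ P ((x , y) , d) with P (x , y) | d
... | cross   | fromW = ℤ.i≤i+j x (+ 1) , ℤ.≤-refl
... | cross   | fromS = ℤ.≤-refl , ℤ.i≤i+j y (+ 1)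
... | contact | fromW = ℤ.≤-refl , ℤ.i≤i+j y (+ 1)
... | contact | fromS = ℤ.i≤i+j x (+ 1) , ℤ.≤-refl

iter : PipeDream → ℕ → State → State
iter P zero    s = s
iter P (suc k) s = next P (iter P k s)

iter-next : ∀ P k s → iter P k (next P s) ≡ iter P (suc k) s
iter-next P zero    s = refl
iter-next P (suc k) s = cong (next P) (iter-next P k s)

iter-+ : ∀ P m k s → iter P m (iter P k s) ≡ iter P (m ℕ.+ k) s
iter-+ P zero    k s = refl
iter-+ P (suc m) k s = cong (next P) (iter-+ P m k s)

iter-injective : ∀ P k {s s'} → iter P k s ≡ iter P k s' → s ≡ s'
iter-injective P zero    e = e
iter-injective P (suc k) e = iter-injective P k (next-injective P e)

level-iter : ∀ P k s → level (iter P k s) ≡ level s + + k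
level-iter P zero    s = sym (ℤ.+-identityʳ (level s))
level-iter P (suc k) s = begin
  level (next P (iter P k s)) ≡⟨ level-next P (iter P k s) ⟩
  level (iter P k s) + + 1    ≡⟨ cong (_+ + 1) (level-iter P k s) ⟩
  level s + + k + + 1         ≡⟨ ℤ.+-assoc (level s) (+ k) (+ 1) ⟩
  level s + + (k ℕ.+ 1)       ≡⟨ cong (λ m → level s + + m) (ℕ.+-comm k 1) ⟩
  level s + + suc k           ∎
  where open ≡-Reasoning

cell-iter-≽ : ∀ P k s → proj₁ s ≼ proj₁ (iter P k s)
cell-iter-≽ P zero    s = ℤ.≤-refl , ℤ.≤-refl
cell-iter-≽ P (suc k) s = ≼-trans (cell-iter-≽ P k s) (cell-next-≽ P (iter P k s))

Close : ℕ → ℤ → ℤ → Set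
Close d a b = a ≤ b + + d × b ≤ a + + d

close-refl : ∀ {a} → Close 0 a a
close-refl {a} = ℤ.≤-reflexive (sym (ℤ.+-identityʳ a)) , ℤ.≤-reflexive (sym (ℤ.+-identityʳ a))

close-sym : ∀ {d a b} → Close d a b → Close d b a
close-sym (a≤ , b≤) = b≤ , a≤

close-trans : ∀ {d e a b c} → Close d a b → Close e b c → Close (d ℕ.+ e) a c
close-trans {d} {e} {a} {b} {c} (a≤b+d , b≤a+d) (b≤c+e , c≤b+e) =
  ℤ.≤-trans a≤b+d
    (ℤ.≤-trans (ℤ.+-monoˡ-≤ (+ d) b≤c+e) (ℤ.≤-reflexive (regroup c e d))) ,
  ℤ.≤-trans c≤b+e
    (ℤ.≤-trans (ℤ.+-monoˡ-≤ (+ e) b≤a+d) (ℤ.≤-reflexive (ℤ.+-assoc a (+ d) (+ e))))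
  where
  regroup : ∀ z m k → z + + m + + k ≡ z + + (k ℕ.+ m)
  regroup z m k = trans (ℤ.+-assoc z (+ m) (+ k)) (cong (λ i → z + + i) (ℕ.+-comm m k))

close-gap : ∀ {i j d} a → i ℕ.≤ j → Close (j ∸ i) a (a + + d) → i ℕ.+ d ℕ.≤ j
close-gap {i} a i≤j (_ , a+d≤a+gap) =
  ℕ.≤-trans (ℕ.+-monoʳ-≤ i (ℤ.drop‿+≤+ (+-cancelˡ-≤ a a+d≤a+gap)))
    (ℕ.≤-reflexive (ℕ.m+[n∸m]≡n i≤j))

offset-next-close : ∀ P s → Close 1 (offset s) (offset (next P s))
offset-next-close P s@(c , d) =
  ℤ.≤-trans (ℤ.≤-reflexive (sym (//-rightDividesˡ (+ 1) (offset s))))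
    (ℤ.≤-trans (ℤ.+-monoˡ-≤ (+ 1) (ℤ.+-monoʳ-≤ (offset s) (drift-≥ (P c) d)))
      (ℤ.≤-reflexive (cong (_+ + 1) (sym (offset-next P s))))) ,
  ℤ.≤-trans (ℤ.≤-reflexive (offset-next P s)) (ℤ.+-monoʳ-≤ (offset s) (drift-≤ (P c) d))

offset-iter-close : ∀ P k s → Close k (offset s) (offset (iter P k s))
offset-iter-close P zero    s = close-refl
offset-iter-close P (suc k) s =
  subst (λ m → Close m (offset s) (offset (iter P (suc k) s))) (ℕ.+-comm k 1)
    (close-trans (offset-iter-close P k s) (offset-next-close P (iter P k s)))

west-before-south : ∀ c → offset (c , fromW) < offset (c , fromS)
west-before-south (x , y) = subst (x - y - + 1 <_) (//-rightDividesˡ (+ 1) (x - y)) (<+1 (x - y - + 1))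

rising-step : ∀ P s → offset (next P s) ≡ offset s + + 1 → P (proj₁ s) ≡ cross × proj₂ s ≡ fromW
rising-step P s@(c , d) e = drift-up (P c) d (∙-cancelˡ (offset s) _ _ (trans (sym (offset-next P s)) e))

falling-step : ∀ P s → offset s ≡ offset (next P s) + + 1 → P (proj₁ s) ≡ cross × proj₂ s ≡ fromS
falling-step P s@(c , d) e = drift-down (P c) d (inverseˡ-unique _ _ (identityʳ-unique (offset s) _ (sym (begin
  offset s                             ≡⟨ e ⟩
  offset (next P s) + + 1              ≡⟨ cong (_+ + 1) (offset-next P s) ⟩
  offset s + drift (P c) d + + 1        ≡⟨ ℤ.+-assoc (offset s) (drift (P c) d) (+ 1) ⟩
  offset s + (drift (P c) d + + 1)      ∎))))
  where open ≡-Reasoning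

-- Offsets move by at most one per step, so if p ends up southeast of q, which was at least one
-- position southeast of p, then p rose and q fell by one, starting from adjacent edges of one cell.
overtaking : ∀ P {sp sq} → level sp ≡ level sq → offset sp < offset sq →
  offset (next P sq) < offset (next P sp) →
  Σ[ c ∈ Cell ] (P c ≡ cross × sp ≡ (c , fromW) × sq ≡ (c , fromS))
overtaking P {cp , dp} {cq , dq} l sp<sq nq<np
  with ≤-cycle (<⇒+1≤ sp<sq) (proj₁ (offset-next-close P (cq , dq)))
               (<⇒+1≤ nq<np) (proj₂ (offset-next-close P (cp , dp)))
... | p+1≡q , q≡nq+1 , nq+1≡np
  with rising-step P (cp , dp) (sym (trans p+1≡q (trans q≡nq+1 nq+1≡np))) | falling-step P (cq , dq) q≡nq+1
... | cross-p , refl | _ , refl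
  with state-determined {cp , fromS} {cq , fromS} l
         (trans (sym (//-rightDividesˡ (+ 1) (offset (cp , fromS)))) p+1≡q)
... | refl = cp , cross-p , refl , refl

-- Discrete intermediate value theorem for the offsets of two pipes.
crossing : ∀ P m {sp sq} → level sp ≡ level sq → offset sp ≤ offset sq →
  offset (iter P m sq) < offset (iter P m sp) →
  Σ[ k ∈ ℕ ] Σ[ c ∈ Cell ]
    (k ℕ.< m × P c ≡ cross × iter P k sp ≡ (c , fromW) × iter P k sq ≡ (c , fromS))
crossing P zero    l sp≤sq sq<sp = ⊥-elim (ℤ.<⇒≱ sq<sp sp≤sq)
crossing P (suc m) {sp} {sq} l sp≤sq end with ℤ.<-cmp (offset sp) (offset sq)
... | tri> _ _ sq<sp = ⊥-elim (ℤ.<⇒≱ sq<sp sp≤sq)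
... | tri≈ _ sp≡sq _ with state-determined {sp} {sq} l sp≡sq
...   | refl = ⊥-elim (ℤ.<-irrefl refl end)
crossing P (suc m) {sp} {sq} l sp≤sq end | tri< sp<sq _ _
  with offset (next P sp) ℤ.≤? offset (next P sq)
... | no np≰nq with overtaking P l sp<sq (ℤ.≰⇒> np≰nq)
...   | c , cr , refl , refl = 0 , c , s≤s z≤n , cr , refl , refl
crossing P (suc m) {sp} {sq} l sp≤sq end | tri< sp<sq _ _ | yes np≤nq
  with crossing P m (trans (level-next P sp) (trans (cong (_+ + 1) l) (sym (level-next P sq)))) np≤nq
         (subst₂ (λ u v → offset u < offset v) (sym (iter-next P m sq)) (sym (iter-next P m sp)) end)
... | k , c , k<m , cr , at-p , at-q =
  suc k , c , s≤s k<m , cr , trans (sym (iter-next P k sp)) at-p , trans (sym (iter-next P k sq)) at-q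

close-eq : ∀ {d a b} → a ≡ b → Close d a b
close-eq {d} {a} refl = ℤ.i≤i+j a (+ d) , ℤ.i≤i+j a (+ d)

close-succ : ∀ {a b} → b ≡ a + + 1 → Close 1 a b
close-succ {a} refl = ℤ.≤-trans (ℤ.i≤i+j a (+ 1)) (ℤ.i≤i+j (a + + 1) (+ 1)) , ℤ.≤-refl

entryAlong : ∀ {m} → Point → Vec SEStep m → Fin m → State
entryAlong v vs i = stepState (walk v (take (toℕ i) (seList vs))) (Vec.lookup vs i)

offset-entryAlong : ∀ {m} v (vs : Vec SEStep m) i →
  offset (entryAlong v vs i) ≡ (proj₁ v - proj₂ v) + + toℕ i
offset-entryAlong (x , y) (east  ∷ vs) Fin.zero    = sym (ℤ.+-identityʳ (x - y))
offset-entryAlong (x , y) (south ∷ vs) Fin.zero    = offset-south x y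
  where
  offset-south : ∀ x y → x - (y - + 1) - + 1 ≡ (x - y) + + 0
  offset-south = solve-∀
offset-entryAlong (x , y) (east  ∷ vs) (Fin.suc i) =
  trans (offset-entryAlong (x + + 1 , y) vs i) (shift-east x y (+ toℕ i))
  where
  shift-east : ∀ x y k → (x + + 1) - y + k ≡ (x - y) + (+ 1 + k)
  shift-east = solve-∀
offset-entryAlong (x , y) (south ∷ vs) (Fin.suc i) =
  trans (offset-entryAlong (x , y - + 1) vs i) (shift-south x y (+ toℕ i))
  where
  shift-south : ∀ x y k → x - (y - + 1) + k ≡ (x - y) + (+ 1 + k)
  shift-south = solve-∀

entryAlong-level-step : ∀ {m} v s s' (vs : Vec SEStep m) →
  Close 1 (level (entryAlong v (s ∷ s' ∷ vs) Fin.zero))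
          (level (entryAlong (move v (toDir s)) (s' ∷ vs) Fin.zero))
entryAlong-level-step (x , y) east  east  vs = close-succ (level-east x y)
entryAlong-level-step (x , y) east  south vs = close-eq (sym (diagonal x y))
  where
  diagonal : ∀ x y → (x + + 1) + (y - + 1) ≡ x + y
  diagonal = solve-∀
entryAlong-level-step (x , y) south east  vs = close-eq refl
entryAlong-level-step (x , y) south south vs = close-sym (close-succ (down x y))
  where
  down : ∀ x y → x + (y - + 1) ≡ (x + (y - + 1 - + 1)) + + 1
  down = solve-∀

entryAlong-level-close : ∀ {m} v (vs : Vec SEStep m) i j → toℕ i ℕ.≤ toℕ j →
  Close (toℕ j ∸ toℕ i) (level (entryAlong v vs i)) (level (entryAlong v vs j))
entryAlong-level-close v (s ∷ vs)       Fin.zero    Fin.zero    _   = close-refl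
entryAlong-level-close v (s ∷ vs)       (Fin.suc i) (Fin.suc j) i≤j =
  entryAlong-level-close (move v (toDir s)) vs i j (ℕ.s≤s⁻¹ i≤j)
entryAlong-level-close v (s ∷ s' ∷ vs) Fin.zero    (Fin.suc j) _   =
  close-trans (entryAlong-level-step v s s' vs)
    (entryAlong-level-close (move v (toDir s)) (s' ∷ vs) Fin.zero j z≤n)

entryAlong-edge : ∀ {m} v (vs : Vec SEStep m) i →
  stepEdge (walk v (take (toℕ i) (seList vs))) (toDir (Vec.lookup vs i)) ∈ pathEdges v (seList vs)
entryAlong-edge v (s ∷ vs) Fin.zero    = here refl
entryAlong-edge v (s ∷ vs) (Fin.suc i) = there (entryAlong-edge (move v (toDir s)) vs i)

step-sides : ∀ u s → side₁ (stepEdge u (toDir s)) ≡ proj₁ (stepState u s)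
                   × side₂ (stepEdge u (toDir s)) ≡ prevCell (stepState u s)
step-sides (x , y) east  = refl , refl
step-sides (x , y) south = refl , refl

module Pipes {n : ℕ} (F : AltShape n) (P : PipeDream) where

  InF : State → Set
  InF s = proj₁ s ∈ cells F

  StaysIn : State → ℕ → Set
  StaysIn s k = ∀ j → j ℕ.≤ k → InF (iter P j s)

  Reaches : State → State → Set
  Reaches s s' = Σ[ k ∈ ℕ ] (iter P k s ≡ s' × StaysIn s k)

  Passes : Fin n → State → Set
  Passes a = Reaches (entry F a)

  staysIn-next : ∀ {s k} → StaysIn s (suc k) → StaysIn (next P s) k
  staysIn-next {s} stays j j≤k = subst InF (sym (iter-next P j s)) (stays (suc j) (s≤s j≤k))

  visits⇒reaches : ∀ {s s'} → Visits F P s s' → Reaches s s'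
  visits⇒reaches (here s∈F) = 0 , refl , λ { zero _ → s∈F }
  visits⇒reaches {s} (there s∈F v) with visits⇒reaches v
  ... | k , refl , stays =
    suc k , sym (iter-next P k s) ,
    λ { zero _ → s∈F ; (suc j) j≤k → subst InF (iter-next P j s) (stays j (ℕ.s≤s⁻¹ j≤k)) }

  visits-after : ∀ k {s s'} → iter P k s ≡ s' → StaysIn s k → Visits F P s s'
  visits-after zero    refl stays = here (stays 0 z≤n)
  visits-after (suc k) {s} end stays =
    there (stays 0 z≤n) (visits-after k (trans (iter-next P k s) end) (staysIn-next stays))

  reaches⇒visits : ∀ {s s'} → Reaches s s' → Visits F P s s'
  reaches⇒visits (k , end , stays) = visits-after k end stays

  reaches-prefix : ∀ {s k j} → StaysIn s k → j ℕ.≤ k → Reaches s (iter P j s)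
  reaches-prefix stays j≤k = _ , refl , λ i i≤j → stays i (ℕ.≤-trans i≤j j≤k)

  reaches-next : ∀ {s s'} → Reaches s s' → InF (next P s') → Reaches s (next P s')
  reaches-next (k , refl , stays) next∈F = suc k , refl , extend
    where
    extend : StaysIn _ (suc k)
    extend j j≤1+k with ℕ.m≤n⇒m<n∨m≡n j≤1+k
    ... | inj₁ j<1+k = stays j (ℕ.s≤s⁻¹ j<1+k)
    ... | inj₂ refl  = next∈F

  level-reaches : ∀ {s s'} → (r : Reaches s s') → level s' ≡ level s + + proj₁ r
  level-reaches {s} (k , refl , _) = level-iter P k s

  reaches-level-≤ : ∀ {s s'} → Reaches s s' → level s ≤ level s'
  reaches-level-≤ {s} r = subst (level s ≤_) (sym (level-reaches r)) (ℤ.i≤i+j (level s) (+ proj₁ r))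

  offset-entry : ∀ a → offset (entry F a) ≡ + toℕ a
  offset-entry a = offset-entryAlong origin (start F) a

  entry-injective : ∀ {a b} → entry F a ≡ entry F b → a ≡ b
  entry-injective {a} {b} e =
    Fin.toℕ-injective (ℤ.+-injective (trans (sym (offset-entry a)) (trans (cong offset e) (offset-entry b))))

  entry-levels-close : ∀ {a b} → a Fin.< b → Close (toℕ b ∸ toℕ a) (level (entry F a)) (level (entry F b))
  entry-levels-close {a} {b} a<b = entryAlong-level-close origin (start F) a b (ℕ.<⇒≤ a<b)

  later-entry-gap : ∀ {a b d} → a Fin.< b → level (entry F b) ≡ level (entry F a) + + d →
    toℕ a ℕ.+ d ℕ.≤ toℕ b
  later-entry-gap {a} {b} a<b later =
    close-gap (level (entry F a)) (ℕ.<⇒≤ a<b)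
      (subst (Close _ (level (entry F a))) later (entry-levels-close a<b))

  earlier-entry-gap : ∀ {a b d} → a Fin.< b → level (entry F a) ≡ level (entry F b) + + d →
    toℕ a ℕ.+ d ℕ.≤ toℕ b
  earlier-entry-gap {a} {b} a<b earlier =
    close-gap (level (entry F b)) (ℕ.<⇒≤ a<b)
      (close-sym (subst (λ l → Close _ l (level (entry F b))) earlier (entry-levels-close a<b)))

  -- Entry edges lie on the boundary of F.
  entry-unreachable : ∀ {s a} → InF s → InF (entry F a) → next P s ≢ entry F a
  entry-unreachable {s} {a} s∈F entry∈F e
    with paths→boundary F _ (∈-++⁺ˡ (entryAlong-edge origin (start F) a))
       | step-sides (walk origin (take (toℕ a) (seList (start F)))) (Vec.lookup (start F) a)
  ... | inj₁ (_ , outside) | _ , side₂≡ =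
    outside (subst (_∈ cells F) (sym (trans side₂≡ (trans (cong prevCell (sym e)) (cong proj₁ (prev-next P s)))))
                   s∈F)
  ... | inj₂ (outside , _) | side₁≡ , _ = outside (subst (_∈ cells F) (sym side₁≡) entry∈F)

  entry-not-revisited : ∀ {s a k k'} → StaysIn s k' → k ℕ.< k' → iter P k' s ≡ iter P k (entry F a) →
    InF (entry F a) → ⊥
  entry-not-revisited {s} {a} {k} stays k<k' e entry∈F with ℕ.m≤n⇒∃[o]m+o≡n k<k'
  ... | o , refl = entry-unreachable (stays o (ℕ.m≤n+m o (suc k) )) entry∈F (iter-injective P k (begin
    iter P k (iter P (suc o) s) ≡⟨ iter-+ P k (suc o) s ⟩
    iter P (k ℕ.+ suc o) s      ≡⟨ cong (λ m → iter P m s) (ℕ.+-suc k o) ⟩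
    iter P (suc k ℕ.+ o) s      ≡⟨ e ⟩
    iter P k (entry F a)        ∎))
    where open ≡-Reasoning

  pipes-disjoint : ∀ {a b s} → Passes a s → Passes b s → a ≡ b
  pipes-disjoint {a} {b} (ka , ea , sa) (kb , eb , sb) with ℕ.<-cmp ka kb
  ... | tri≈ _ refl _  = entry-injective (iter-injective P ka (trans ea (sym eb)))
  ... | tri< ka<kb _ _ = ⊥-elim (entry-not-revisited sb ka<kb (trans eb (sym ea)) (sa 0 z≤n))
  ... | tri> _ _ kb<ka = ⊥-elim (entry-not-revisited sa kb<ka (trans ea (sym eb)) (sb 0 z≤n))

  passes-level-unique : ∀ {a s s'} → Passes a s → Passes a s' → level s ≡ level s' → s ≡ s'
  passes-level-unique {a} r@(k , refl , _) r'@(k' , refl , _) l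
    with ℤ.+-injective (∙-cancelˡ (level (entry F a)) _ _
           (trans (sym (level-reaches r)) (trans l (level-reaches r'))))
  ... | refl = refl

  record EarlierCross (p q : Fin n) (y : Cell) : Set where
    field
      x          : Cell
      cross-x    : P x ≡ cross
      p-x        : Passes p (x , fromW)
      q-x        : Passes q (x , fromS)
      x-before-y : cellLevel x < cellLevel y

  passes-after : ∀ {a K} k d → StaysIn (entry F a) K → k ℕ.+ d ℕ.≤ K →
    Passes a (iter P k (iter P d (entry F a)))
  passes-after {a} {K} k d stays k+d≤K =
    k ℕ.+ d , sym (iter-+ P k d (entry F a)) , λ j j≤ → stays j (ℕ.≤-trans j≤ k+d≤K)

  crossing-aligned : ∀ {p q y sp sq} m → level sp ≡ level sq → offset sp ≤ offset sq →
    iter P m sp ≡ (y , fromS) → iter P m sq ≡ (y , fromW) →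
    (∀ k → k ℕ.≤ m → Passes p (iter P k sp)) → (∀ k → k ℕ.≤ m → Passes q (iter P k sq)) →
    EarlierCross p q y
  crossing-aligned {p} {q} {y} {sp} {sq} m l sp≤sq at-p at-q along-p along-q
    with crossing P m l sp≤sq
           (subst₂ (λ u v → offset u < offset v) (sym at-q) (sym at-p) (west-before-south y))
  ... | k , x , k<m , cr , x-p , x-q = record
    { x = x ; cross-x = cr
    ; p-x = subst (Passes p) x-p (along-p k (ℕ.<⇒≤ k<m))
    ; q-x = subst (Passes q) x-q (along-q k (ℕ.<⇒≤ k<m))
    ; x-before-y = below }
    where
    open ℤ.≤-Reasoning
    below : cellLevel x < cellLevel y
    below = begin-strict
      cellLevel x          ≡⟨ cong level x-p ⟨
      level (iter P k sp)  ≡⟨ level-iter P k sp ⟩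
      level sp + + k       <⟨ ℤ.+-monoʳ-< (level sp) (+<+ k<m) ⟩
      level sp + + m       ≡⟨ level-iter P m sp ⟨
      level (iter P m sp)  ≡⟨ cong level at-p ⟩
      cellLevel y          ∎

  -- Advance the pipe that entered earlier to the antidiagonal of the other entry: p is still
  -- northwest of q there, since the entries advance by at most one antidiagonal per step.
  crossing-before-contact : ∀ {p q y} → p Fin.< q → Passes q (y , fromW) → Passes p (y , fromS) →
    EarlierCross p q y
  crossing-before-contact {p} {q} {y} p<q rq@(kq , eq , stays-q) rp@(kp , ep , stays-p)
    with ℕ.≤-total kq kp
  ... | inj₁ kq≤kp with ℕ.m≤n⇒∃[o]m+o≡n kq≤kp
  ...   | d , refl =
    crossing-aligned kq (trans (level-iter P d (entry F p)) (sym q-later)) p-behind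
      (trans (iter-+ P kq d (entry F p)) ep) eq
      (λ k k≤kq → passes-after k d stays-p (ℕ.+-monoˡ-≤ d k≤kq))
      (λ k k≤kq → reaches-prefix stays-q k≤kq)
    where
    q-later : level (entry F q) ≡ level (entry F p) + + d
    q-later = +-cancel-shift (level (entry F p)) (level (entry F q)) kq d
                (trans (sym (level-reaches rq)) (level-reaches rp))
    p-behind : offset (iter P d (entry F p)) ≤ offset (entry F q)
    p-behind = ℤ.≤-trans (proj₂ (offset-iter-close P d (entry F p)))
      (subst₂ (λ u v → u + + d ≤ v) (sym (offset-entry p)) (sym (offset-entry q))
        (+≤+ (later-entry-gap p<q q-later)))
  crossing-before-contact {p} {q} {y} p<q rq@(kq , eq , stays-q) rp@(kp , ep , stays-p)
    | inj₂ kp≤kq with ℕ.m≤n⇒∃[o]m+o≡n kp≤kq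
  ...   | d , refl =
    crossing-aligned kp (trans p-later (sym (level-iter P d (entry F q)))) q-ahead
      ep (trans (iter-+ P kp d (entry F q)) eq)
      (λ k k≤kp → reaches-prefix stays-p k≤kp)
      (λ k k≤kp → passes-after k d stays-q (ℕ.+-monoˡ-≤ d k≤kp))
    where
    p-later : level (entry F p) ≡ level (entry F q) + + d
    p-later = +-cancel-shift (level (entry F q)) (level (entry F p)) kp d
                (trans (sym (level-reaches rp)) (level-reaches rq))
    q-ahead : offset (entry F p) ≤ offset (iter P d (entry F q))
    q-ahead = +-cancelʳ-≤ (+ d) (ℤ.≤-trans
      (subst₂ (λ u v → u + + d ≤ v) (sym (offset-entry p)) (sym (offset-entry q))
        (+≤+ (earlier-entry-gap p<q p-later)))
      (proj₁ (offset-iter-close P d (entry F q))))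

  trace-length : ∀ {s e} → Trace F P s e →
    Σ[ L ∈ ℕ ] ((∀ j → j ℕ.< L → InF (iter P j s)) × ¬ InF (iter P L s))
  trace-length (stop s∉F) = 0 , (λ _ ()) , s∉F
  trace-length {s} (go s∈F trace) with trace-length trace
  ... | L , inside , outside =
    suc L ,
    (λ { zero _ → s∈F ; (suc j) j<1+L → subst InF (iter-next P j s) (inside j (ℕ.s≤s⁻¹ j<1+L)) }) ,
    outside ∘ subst InF (sym (iter-next P L s))

  module Exiting {ω : Permutation′ n} (exits : HasExit F P ω) where

    pipe-trace : ∀ a → Trace F P (entry F a) (exitSt F (ω ⟨$⟩ˡ a))
    pipe-trace a =
      subst (λ b → Trace F P (entry F b) (exitSt F (ω ⟨$⟩ˡ a))) (inverseʳ ω) (exits (ω ⟨$⟩ˡ a))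

    pipe-length : Fin n → ℕ
    pipe-length a = proj₁ (trace-length (pipe-trace a))

    passes-bounded : ∀ {a s} (r : Passes a s) → proj₁ r ℕ.< pipe-length a
    passes-bounded {a} (k , _ , stays) with k ℕ.<? pipe-length a
    ... | yes k<L = k<L
    ... | no  k≮L = ⊥-elim (proj₂ (proj₂ (trace-length (pipe-trace a))) (stays _ (ℕ.≮⇒≥ k≮L)))

    passes? : ∀ a s → Dec (Passes a s)
    passes? a s with Fin.any? (λ (k : Fin (pipe-length a)) → iter P (toℕ k) (entry F a) ≟ˢᵗ s)
    ... | yes (k , at) = yes (toℕ k , at , λ j j≤k →
            proj₁ (proj₂ (trace-length (pipe-trace a))) j (ℕ.≤-<-trans j≤k (Fin.toℕ<n k)))
    ... | no  never = no λ r → never (Fin.fromℕ< (passes-bounded r) ,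
            trans (cong (λ k → iter P k (entry F a)) (Fin.toℕ-fromℕ< (passes-bounded r)))
                  (proj₁ (proj₂ r)))

largest : ∀ {G : ℕ → Set} → (∀ k → Dec (G k)) → ∀ L {k₀} → k₀ ℕ.< L → G k₀ →
  Σ[ K ∈ ℕ ] (K ℕ.< L × G K × (∀ k → k ℕ.< L → G k → k ℕ.≤ K))
largest G? (suc L) k₀<1+L g₀ with G? L
... | yes g = L , ℕ.n<1+n L , g , λ _ k<1+L _ → ℕ.s≤s⁻¹ k<1+L
... | no ¬g with largest G? L (ℕ.≤∧≢⇒< (ℕ.s≤s⁻¹ k₀<1+L) λ { refl → ¬g g₀ }) g₀
...   | K , K<L , gK , maximal =
  K , ℕ.m<n⇒m<1+n K<L , gK ,
  λ k k<1+L gk → maximal k (ℕ.≤∧≢⇒< (ℕ.s≤s⁻¹ k<1+L) λ { refl → ¬g gk }) gk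

transpose-matchˡ : ∀ {n} (i j : Fin n) {k} → k ≡ i → transpose i j k ≡ j
transpose-matchˡ i j refl rewrite dec-true (i Fin.≟ i) refl = refl

transpose-matchʳ : ∀ {n} (i j : Fin n) {k} → k ≡ j → transpose i j k ≡ i
transpose-matchʳ i j refl with j Fin.≟ i
... | yes j≡i = j≡i
... | no  _   rewrite dec-true (j Fin.≟ j) refl = refl

transpose-other : ∀ {n} {i j k : Fin n} → k ≢ i → k ≢ j → transpose i j k ≡ k
transpose-other {i = i} {j} {k} k≢i k≢j
  rewrite dec-false (k Fin.≟ i) k≢i | dec-false (k Fin.≟ j) k≢j = refl

transpose-≡ʳ : ∀ {n} {i j k : Fin n} → transpose i j k ≡ j → k ≡ i
transpose-≡ʳ {i = i} {j} e =
  trans (sym (transpose-inverse j i)) (trans (cong (transpose j i) e) (transpose-matchˡ j i refl))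

transpose-≡ˡ : ∀ {n} {i j k : Fin n} → transpose i j k ≡ i → k ≡ j
transpose-≡ˡ {i = i} {j} e =
  trans (sym (transpose-inverse j i)) (trans (cong (transpose j i) e) (transpose-matchʳ j i refl))

adjacent-< : ∀ {n} {i j : Fin n} → toℕ j ≡ suc (toℕ i) → i Fin.< j
adjacent-< {i = i} j≡1+i = subst (toℕ i ℕ.<_) (sym j≡1+i) (ℕ.n<1+n (toℕ i))

transpose-adjacent-< : ∀ {n} {i j u v : Fin n} → toℕ j ≡ suc (toℕ i) → u Fin.< v → ¬ (u ≡ i × v ≡ j) →
  transpose i j u Fin.< transpose i j v
transpose-adjacent-< {i = i} {j} {u} {v} j≡1+i u<v not-ij =
  cases (u Fin.≟ i) (u Fin.≟ j) (v Fin.≟ i) (v Fin.≟ j)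
  where
  i<j : i Fin.< j
  i<j = adjacent-< j≡1+i
  ordered : ∀ {u' v'} → transpose i j u ≡ u' → transpose i j v ≡ v' → u' Fin.< v' →
    transpose i j u Fin.< transpose i j v
  ordered refl refl u'<v' = u'<v'
  cases : Dec (u ≡ i) → Dec (u ≡ j) → Dec (v ≡ i) → Dec (v ≡ j) →
    transpose i j u Fin.< transpose i j v
  cases (yes refl) _ (yes refl) _ = ⊥-elim (ℕ.<-irrefl refl u<v)
  cases (yes u≡i) _ (no _) (yes v≡j) = ⊥-elim (not-ij (u≡i , v≡j))
  cases (yes refl) _ (no v≢i) (no v≢j) =
    ordered (transpose-matchˡ i j refl) (transpose-other v≢i v≢j)
      (ℕ.≤∧≢⇒< (subst (ℕ._≤ toℕ v) (sym j≡1+i) u<v) (λ j≡v → v≢j (Fin.toℕ-injective (sym j≡v))))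
  cases (no _) (yes refl) (yes refl) _ = ⊥-elim (ℕ.<-asym u<v i<j)
  cases (no _) (yes refl) (no _) (yes refl) = ⊥-elim (ℕ.<-irrefl refl u<v)
  cases (no _) (yes refl) (no v≢i) (no v≢j) =
    ordered (transpose-matchʳ i j refl) (transpose-other v≢i v≢j) (ℕ.<-trans i<j u<v)
  cases (no u≢i) (no u≢j) (yes refl) _ =
    ordered (transpose-other u≢i u≢j) (transpose-matchˡ i j refl) (ℕ.<-trans u<v i<j)
  cases (no u≢i) (no u≢j) (no _) (yes refl) =
    ordered (transpose-other u≢i u≢j) (transpose-matchʳ i j refl)
      (ℕ.≤∧≢⇒< (ℕ.s≤s⁻¹ (subst (toℕ u ℕ.<_) j≡1+i u<v)) (λ u≡i → u≢i (Fin.toℕ-injective u≡i)))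
  cases (no u≢i) (no u≢j) (no v≢i) (no v≢j) =
    ordered (transpose-other u≢i u≢j) (transpose-other v≢i v≢j) u<v

position-of : ∀ {n} (π : Permutation′ n) {k a} → π ⟨$⟩ʳ k ≡ a → π ⟨$⟩ˡ a ≡ k
position-of π {k} refl = inverseˡ π

at-position : ∀ {n} (π : Permutation′ n) {k a} → π ⟨$⟩ˡ a ≡ k → π ⟨$⟩ʳ k ≡ a
at-position π {a = a} refl = inverseʳ π

module Swapped {n : ℕ} {p q : Fin n} {π' π : Permutation′ n} {i j : Fin n}
  (j≡1+i : toℕ j ≡ suc (toℕ i)) (π'i : π' ⟨$⟩ʳ i ≡ p) (π'j : π' ⟨$⟩ʳ j ≡ q) (πi : π ⟨$⟩ʳ i ≡ q)
  (πj : π ⟨$⟩ʳ j ≡ p) (others : ∀ k → k ≢ i → k ≢ j → π ⟨$⟩ʳ k ≡ π' ⟨$⟩ʳ k) where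

  i<j : i Fin.< j
  i<j = adjacent-< j≡1+i

  position′ : ∀ a → π' ⟨$⟩ˡ a ≡ transpose i j (π ⟨$⟩ˡ a)
  position′ a = cases (π ⟨$⟩ˡ a Fin.≟ i) (π ⟨$⟩ˡ a Fin.≟ j)
    where
    cases : Dec (π ⟨$⟩ˡ a ≡ i) → Dec (π ⟨$⟩ˡ a ≡ j) → π' ⟨$⟩ˡ a ≡ transpose i j (π ⟨$⟩ˡ a)
    cases (yes on-i) _ =
      trans (position-of π' (trans π'j (trans (sym πi) (at-position π on-i)))) (sym (transpose-matchˡ i j on-i))
    cases (no _) (yes on-j) =
      trans (position-of π' (trans π'i (trans (sym πj) (at-position π on-j)))) (sym (transpose-matchʳ i j on-j))
    cases (no off-i) (no off-j) =
      trans (position-of π' (trans (sym (others _ off-i off-j)) (inverseʳ π))) (sym (transpose-other off-i off-j))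

  transposed-position : ∀ a → π ⟨$⟩ˡ transpose p q a ≡ transpose i j (π ⟨$⟩ˡ a)
  transposed-position a = cases (a Fin.≟ p) (a Fin.≟ q)
    where
    cases : Dec (a ≡ p) → Dec (a ≡ q) → π ⟨$⟩ˡ transpose p q a ≡ transpose i j (π ⟨$⟩ˡ a)
    cases (yes refl) _ =
      trans (cong (π ⟨$⟩ˡ_) (transpose-matchˡ p q refl))
        (trans (position-of π πi) (sym (transpose-matchʳ i j (position-of π πj))))
    cases (no _) (yes refl) =
      trans (cong (π ⟨$⟩ˡ_) (transpose-matchʳ p q refl))
        (trans (position-of π πj) (sym (transpose-matchˡ i j (position-of π πi))))
    cases (no a≢p) (no a≢q) =
      trans (cong (π ⟨$⟩ˡ_) (transpose-other a≢p a≢q))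
        (sym (transpose-other (λ on-i → a≢q (trans (sym (at-position π on-i)) πi))
                              (λ on-j → a≢p (trans (sym (at-position π on-j)) πj))))

  relabelled-position : ∀ a → π' ⟨$⟩ˡ a ≡ π ⟨$⟩ˡ transpose p q a
  relabelled-position a = trans (position′ a) (sym (transposed-position a))

  order-kept : ∀ {a b} → π ⟨$⟩ˡ a Fin.< π ⟨$⟩ˡ b → ¬ (a ≡ q × b ≡ p) → π' ⟨$⟩ˡ a Fin.< π' ⟨$⟩ˡ b
  order-kept {a} {b} a<b not-qp =
    subst₂ Fin._<_ (sym (position′ a)) (sym (position′ b))
      (transpose-adjacent-< j≡1+i a<b λ (on-i , on-j) →
        not-qp (trans (sym (at-position π on-i)) πi , trans (sym (at-position π on-j)) πj))

  q-before-p : π ⟨$⟩ˡ q Fin.< π ⟨$⟩ˡ p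
  q-before-p = subst₂ Fin._<_ (sym (position-of π πi)) (sym (position-of π πj)) i<j

  p-before-q′ : π' ⟨$⟩ˡ p Fin.< π' ⟨$⟩ˡ q
  p-before-q′ = subst₂ Fin._<_ (sym (position-of π' π'i)) (sym (position-of π' π'j)) i<j

adjSwap-q-before-p : ∀ {n} {p q : Fin n} {π' π} → AdjSwap p q π' π → π ⟨$⟩ˡ q Fin.< π ⟨$⟩ˡ p
adjSwap-q-before-p {π' = π'} {π} (_ , _ , j≡1+i , π'i , π'j , πi , πj , others) =
  Swapped.q-before-p {π' = π'} {π} j≡1+i π'i π'j πi πj others

adjSwap-order-kept : ∀ {n} {p q : Fin n} {π' π} → AdjSwap p q π' π → ∀ {a b} →
  π ⟨$⟩ˡ a Fin.< π ⟨$⟩ˡ b → ¬ (a ≡ q × b ≡ p) → π' ⟨$⟩ˡ a Fin.< π' ⟨$⟩ˡ b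
adjSwap-order-kept {π' = π'} {π} (_ , _ , j≡1+i , π'i , π'j , πi , πj , others) =
  Swapped.order-kept {π' = π'} {π} j≡1+i π'i π'j πi πj others

flip-contact : ∀ P c x → flip P c x c ≡ cross
flip-contact P c x with c ≟ᶜ c
... | yes _   = refl
... | no  c≢c = ⊥-elim (c≢c refl)

flip-cross : ∀ P c x → x ≢ c → flip P c x x ≡ contact
flip-cross P c x x≢c with x ≟ᶜ c
... | yes x≡c = ⊥-elim (x≢c x≡c)
... | no  _ with x ≟ᶜ x
...   | yes _   = refl
...   | no  x≢x = ⊥-elim (x≢x refl)

flip-elsewhere : ∀ P c x {y} → y ≢ c → y ≢ x → flip P c x y ≡ P y
flip-elsewhere P c x {y} y≢c y≢x with y ≟ᶜ c
... | yes y≡c = ⊥-elim (y≢c y≡c)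
... | no  _ with y ≟ᶜ x
...   | yes y≡x = ⊥-elim (y≢x y≡x)
...   | no  _   = refl

next-same-tile : ∀ P Q s → P (proj₁ s) ≡ Q (proj₁ s) → next P s ≡ next Q s
next-same-tile P Q ((x , y) , d) e with P (x , y) | Q (x , y) | d
... | cross   | cross   | fromW = refl
... | cross   | cross   | fromS = refl
... | contact | contact | fromW = refl
... | contact | contact | fromS = refl

next-cross-contact : ∀ P Q c → P c ≡ cross → Q c ≡ contact →
  next P (c , fromW) ≡ next Q (c , fromS) × next P (c , fromS) ≡ next Q (c , fromW)
next-cross-contact P Q (x , y) cr ct with P (x , y) | Q (x , y)
... | cross | contact = refl , refl

-- Flipping the contact c of pipes q (northwest elbow) and p (southeast elbow) with their
-- cross x exchanges the names p and q on the antidiagonals strictly after x up to c.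
module Flipping {n : ℕ} (F : AltShape n) (P : PipeDream) {p q : Fin n} {c x : Cell}
  (contact-c : P c ≡ contact) (q-c : Pipes.Passes F P q (c , fromW)) (p-c : Pipes.Passes F P p (c , fromS))
  (cross-x : P x ≡ cross) (p-x : Pipes.Passes F P p (x , fromW)) (q-x : Pipes.Passes F P q (x , fromS))
  (x-before-c : cellLevel x < cellLevel c) where

  open Pipes F P

  P′ : PipeDream
  P′ = flip P c x

  module P′ = Pipes F P′

  x≢c : x ≢ c
  x≢c refl with trans (sym cross-x) contact-c
  ... | ()

  Window : ℤ → Set
  Window z = cellLevel x < z × z ≤ cellLevel c

  window? : ∀ z → Dec (Window z)
  window? z = (cellLevel x ℤ.<? z) ×-dec (z ℤ.≤? cellLevel c)

  relabel : ℤ → Fin n → Fin n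
  relabel z a with window? z
  ... | yes _ = transpose p q a
  ... | no  _ = a

  relabel-inside : ∀ {z} a → Window z → relabel z a ≡ transpose p q a
  relabel-inside {z} a inside with window? z
  ... | yes _       = refl
  ... | no  outside = ⊥-elim (outside inside)

  relabel-outside : ∀ {z} a → ¬ Window z → relabel z a ≡ a
  relabel-outside {z} a outside with window? z
  ... | yes inside = ⊥-elim (outside inside)
  ... | no  _      = refl

  window-c : Window (cellLevel c)
  window-c = x-before-c , ℤ.≤-refl

  after-c : ¬ Window (cellLevel c + + 1)
  after-c (_ , c+1≤c) = ℤ.<-irrefl refl (ℤ.<-≤-trans (<+1 (cellLevel c)) c+1≤c)

  not-x : ¬ Window (cellLevel x)
  not-x (x<x , _) = ℤ.<-irrefl refl x<x

  after-x : Window (cellLevel x + + 1)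
  after-x = <+1 (cellLevel x) , <⇒+1≤ x-before-c

  relabel-step : ∀ {z} a → z ≢ cellLevel x → z ≢ cellLevel c → relabel (z + + 1) a ≡ relabel z a
  relabel-step {z} a z≢x z≢c with window? z
  ... | yes (x<z , z≤c) = relabel-inside a (ℤ.<-trans x<z (<+1 z) , <⇒+1≤ (ℤ.≤∧≢⇒< z≤c z≢c))
  ... | no  outside     = relabel-outside a λ (x<z+1 , z+1≤c) →
    outside (ℤ.≤∧≢⇒< (<+1⇒≤ x<z+1) (z≢x ∘ sym) , ℤ.≤-trans (ℤ.i≤i+j z (+ 1)) z+1≤c)

  relabel-id : ∀ {z a} → a ≢ p → a ≢ q → relabel z a ≡ a
  relabel-id {z} a≢p a≢q with window? z
  ... | yes _ = transpose-other a≢p a≢q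
  ... | no  _ = refl

  unmoved : ∀ {z a} → relabel z a ≢ p → relabel z a ≢ q → a ≢ p × a ≢ q
  unmoved {z} {a} ≢p ≢q with window? z
  ... | yes _ = (λ { refl → ≢q (transpose-matchˡ p q refl) }) ,
                (λ { refl → ≢p (transpose-matchʳ p q refl) })
  ... | no  _ = ≢p , ≢q

  entry-unrelabelled : ∀ a → relabel (level (entry F a)) a ≡ a
  entry-unrelabelled a with window? (level (entry F a))
  ... | no  _         = refl
  ... | yes (x<a , _) = transpose-other
    (λ { refl → ℤ.<-irrefl refl (ℤ.<-≤-trans x<a (reaches-level-≤ p-x)) })
    (λ { refl → ℤ.<-irrefl refl (ℤ.<-≤-trans x<a (reaches-level-≤ q-x)) })

  handoff : ∀ {b s s'} → Passes b s → next P′ s' ≡ next P s → InF (next P′ s') → Passes b (next P′ s')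
  handoff r e next∈F = subst (Passes _) (sym e) (reaches-next r (subst InF e next∈F))

  renamed : ∀ {a b s} → relabel (level s + + 1) a ≡ b → Passes b (next P′ s) →
    Passes (relabel (level (next P′ s)) a) (next P′ s)
  renamed {a} {s = s} e =
    subst (λ b → Passes b (next P′ s)) (sym (trans (cong (λ z → relabel z a) (level-next P′ s)) e))

  c-flipped : next P′ (c , fromW) ≡ next P (c , fromS) × next P′ (c , fromS) ≡ next P (c , fromW)
  c-flipped = next-cross-contact P′ P c (flip-contact P c x) contact-c

  x-flipped : next P (x , fromW) ≡ next P′ (x , fromS) × next P (x , fromS) ≡ next P′ (x , fromW)
  x-flipped = next-cross-contact P P′ x cross-x (flip-cross P c x x≢c)

  through-c : ∀ {a} d → Passes (relabel (cellLevel c) a) (c , d) → InF (next P′ (c , d)) →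
    Passes (relabel (level (next P′ (c , d))) a) (next P′ (c , d))
  through-c {a} fromW r next∈F =
    renamed (trans (relabel-outside a after-c)
                   (transpose-≡ʳ (trans (sym (relabel-inside a window-c)) (pipes-disjoint r q-c))))
            (handoff p-c (proj₁ c-flipped) next∈F)
  through-c {a} fromS r next∈F =
    renamed (trans (relabel-outside a after-c)
                   (transpose-≡ˡ (trans (sym (relabel-inside a window-c)) (pipes-disjoint r p-c))))
            (handoff q-c (proj₂ c-flipped) next∈F)

  through-x : ∀ {a} d → Passes (relabel (cellLevel x) a) (x , d) → InF (next P′ (x , d)) →
    Passes (relabel (level (next P′ (x , d))) a) (next P′ (x , d))
  through-x {a} fromW r next∈F
    with trans (sym (relabel-outside a not-x)) (pipes-disjoint r p-x)
  ... | refl = renamed (trans (relabel-inside a after-x) (transpose-matchˡ p q refl))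
                       (handoff q-x (sym (proj₂ x-flipped)) next∈F)
  through-x {a} fromS r next∈F
    with trans (sym (relabel-outside a not-x)) (pipes-disjoint r q-x)
  ... | refl = renamed (trans (relabel-inside a after-x) (transpose-matchʳ p q refl))
                       (handoff p-x (sym (proj₁ x-flipped)) next∈F)

  -- Pipes p and q are at x and at c on those antidiagonals.
  levels-avoided : ∀ {b y d} → Passes b (y , d) → b ≡ p ⊎ b ≡ q → y ≢ c → y ≢ x →
    cellLevel y ≢ cellLevel x × cellLevel y ≢ cellLevel c
  levels-avoided r (inj₁ refl) y≢c y≢x =
    (λ l → y≢x (cong proj₁ (passes-level-unique r p-x l))) ,
    (λ l → y≢c (cong proj₁ (passes-level-unique r p-c l)))
  levels-avoided r (inj₂ refl) y≢c y≢x =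
    (λ l → y≢x (cong proj₁ (passes-level-unique r q-x l))) ,
    (λ l → y≢c (cong proj₁ (passes-level-unique r q-c l)))

  elsewhere : ∀ {a y d} → y ≢ c → y ≢ x → Passes (relabel (cellLevel y) a) (y , d) → InF (next P′ (y , d)) →
    Passes (relabel (level (next P′ (y , d))) a) (next P′ (y , d))
  elsewhere {a} {y} {d} y≢c y≢x r next∈F =
    renamed stable (handoff r (next-same-tile P′ P (y , d) (flip-elsewhere P c x y≢c y≢x)) next∈F)
    where
    a′ : Fin n
    a′ = relabel (cellLevel y) a
    stable : relabel (cellLevel y + + 1) a ≡ a′
    stable with a′ Fin.≟ p | a′ Fin.≟ q
    ... | yes a′≡p | _ = uncurry (relabel-step a) (levels-avoided r (inj₁ a′≡p) y≢c y≢x)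
    ... | no _ | yes a′≡q = uncurry (relabel-step a) (levels-avoided r (inj₂ a′≡q) y≢c y≢x)
    ... | no a′≢p | no a′≢q =
      trans (uncurry relabel-id (unmoved a′≢p a′≢q)) (sym (uncurry relabel-id (unmoved a′≢p a′≢q)))

  relabel-next : ∀ {a s} → Passes (relabel (level s) a) s → InF (next P′ s) →
    Passes (relabel (level (next P′ s)) a) (next P′ s)
  relabel-next {a} {y , d} r next∈F = cases (y ≟ᶜ c) (y ≟ᶜ x)
    where
    cases : Dec (y ≡ c) → Dec (y ≡ x) → Passes (relabel (level (next P′ (y , d))) a) (next P′ (y , d))
    cases (yes refl) _        = through-c d r next∈F
    cases (no _)     (yes refl) = through-x d r next∈F
    cases (no y≢c)   (no y≢x)   = elsewhere y≢c y≢x r next∈F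

  relabelling : ∀ {a s} → P′.Passes a s → Passes (relabel (level s) a) s
  relabelling {a} (k , refl , stays) = along k stays
    where
    along : ∀ m → P′.StaysIn (entry F a) m →
      Passes (relabel (level (iter P′ m (entry F a))) a) (iter P′ m (entry F a))
    along zero    inside = subst (λ b → Passes b (entry F a)) (sym (entry-unrelabelled a))
                                 (0 , refl , λ { zero _ → inside 0 z≤n })
    along (suc m) inside = relabel-next (along m (λ j j≤m → inside j (ℕ.m≤n⇒m≤1+n j≤m)))
                                        (inside (suc m) ℕ.≤-refl)

  flipped-linExt : ∀ {π' π} → AdjSwap p q π' π → LinExt (ContactArc F P) π →
    (∀ {y} → P y ≡ contact → Passes q (y , fromW) → Passes p (y , fromS) → Window (cellLevel y)) →
    LinExt (ContactArc F P′) π'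
  flipped-linExt {π'} {π} (i , j , j≡1+i , π'i , π'j , πi , πj , others) lin qp-in-window
    a b (y , contact′ , a-y , b-y) = cases (y ≟ᶜ c) (y ≟ᶜ x)
    where
    open Swapped {p = p} {q} {π'} {π} j≡1+i π'i π'j πi πj others

    a-y′ : Passes (relabel (cellLevel y) a) (y , fromW)
    a-y′ = relabelling (P′.visits⇒reaches a-y)

    b-y′ : Passes (relabel (cellLevel y) b) (y , fromS)
    b-y′ = relabelling (P′.visits⇒reaches b-y)

    order-in-P : P y ≡ contact → π ⟨$⟩ˡ relabel (cellLevel y) a Fin.< π ⟨$⟩ˡ relabel (cellLevel y) b
    order-in-P contact-y = lin _ _ (y , contact-y , reaches⇒visits a-y′ , reaches⇒visits b-y′)

    in-P : P y ≡ contact → Dec (Window (cellLevel y)) → π' ⟨$⟩ˡ a Fin.< π' ⟨$⟩ˡ b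
    in-P contact-y (yes inside) =
      subst₂ Fin._<_ (sym (trans (relabelled-position a) (cong (π ⟨$⟩ˡ_) (sym (relabel-inside a inside)))))
                     (sym (trans (relabelled-position b) (cong (π ⟨$⟩ˡ_) (sym (relabel-inside b inside)))))
        (order-in-P contact-y)
    in-P contact-y (no outside) =
      order-kept (subst₂ (λ u v → π ⟨$⟩ˡ u Fin.< π ⟨$⟩ˡ v) (relabel-outside a outside) (relabel-outside b outside)
                   (order-in-P contact-y))
        λ { (refl , refl) → outside (qp-in-window contact-y
              (subst (λ u → Passes u (y , fromW)) (relabel-outside q outside) a-y′)
              (subst (λ u → Passes u (y , fromS)) (relabel-outside p outside) b-y′)) }

    cases : Dec (y ≡ c) → Dec (y ≡ x) → π' ⟨$⟩ˡ a Fin.< π' ⟨$⟩ˡ b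
    cases (yes refl) _ with trans (sym (flip-contact P c x)) contact′
    ... | ()
    cases (no _) (yes refl)
      with trans (sym (relabel-outside a not-x)) (pipes-disjoint a-y′ p-x)
         | trans (sym (relabel-outside b not-x)) (pipes-disjoint b-y′ q-x)
    ... | refl | refl = p-before-q′
    cases (no y≢c) (no y≢x) =
      in-P (trans (sym (flip-elsewhere P c x y≢c y≢x)) contact′) (window? (cellLevel y))

cellLevel-mono : ∀ {c c'} → c ≼ c' → cellLevel c ≤ cellLevel c'
cellLevel-mono (x≤ , y≤) = ℤ.+-mono-≤ x≤ y≤

-- The contacts with q on the northwest elbow and p on the southeast one lie on pipe q,
-- whose cells move weakly northeast; the last of them is northeastmost.
module NortheastmostContact {n : ℕ} {F : AltShape n} {P : PipeDream} {ω : Permutation′ n}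
  (exits : HasExit F P ω) (p q : Fin n) where

  open Pipes F P
  open Exiting {ω} exits

  along-q : ℕ → State
  along-q k = iter P k (entry F q)

  ContactOnQ : ℕ → Set
  ContactOnQ k =
    P (proj₁ (along-q k)) ≡ contact × proj₂ (along-q k) ≡ fromW × Passes p (proj₁ (along-q k) , fromS)

  contactOnQ? : ∀ k → Dec (ContactOnQ k)
  contactOnQ? k =
    (P (proj₁ (along-q k)) ≟ᵗ contact) ×-dec (proj₂ (along-q k) ≟ˢ fromW)
      ×-dec passes? p (proj₁ (along-q k) , fromS)

  contactOnQ : ∀ {y} → P y ≡ contact → (r : Passes q (y , fromW)) → Passes p (y , fromS) →
    ContactOnQ (proj₁ r)
  contactOnQ contact-y (k , at , _) p-y =
    subst (λ s → P (proj₁ s) ≡ contact) (sym at) contact-y , cong proj₂ at ,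
    subst (λ s → Passes p (proj₁ s , fromS)) (sym at) p-y

  record Last : Set where
    field
      K         : ℕ
      K<length  : K ℕ.< pipe-length q
      contact-K : ContactOnQ K
      maximal   : ∀ k → k ℕ.< pipe-length q → ContactOnQ k → k ℕ.≤ K

  last-contact : ContactArc F P q p → Last
  last-contact (y , contact-y , q-y , p-y)
    with largest contactOnQ? (pipe-length q) (passes-bounded (visits⇒reaches q-y))
           (contactOnQ contact-y (visits⇒reaches q-y) (visits⇒reaches p-y))
  ... | K , K<length , contact-K , maximal =
    record { K = K ; K<length = K<length ; contact-K = contact-K ; maximal = maximal }

  module Chosen (arc : ContactArc F P q p) where

    open Last (last-contact arc)

    c : Cell
    c = proj₁ (along-q K)

    contact-c : P c ≡ contact
    contact-c = proj₁ contact-K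

    q-c : Passes q (c , fromW)
    q-c = K , cong (c ,_) (proj₁ (proj₂ contact-K)) ,
          λ j j≤K → proj₁ (proj₂ (trace-length (pipe-trace q))) j (ℕ.≤-<-trans j≤K K<length)

    p-c : Passes p (c , fromS)
    p-c = proj₂ (proj₂ contact-K)

    dominated : ∀ {y} → P y ≡ contact → Passes q (y , fromW) → Passes p (y , fromS) → y ≼ c
    dominated contact-y q-y@(k , at , _) p-y
      with ℕ.m≤n⇒∃[o]m+o≡n (maximal k (passes-bounded q-y) (contactOnQ contact-y q-y p-y))
    ... | o , k+o≡K =
      subst₂ (λ y' m → y' ≼ proj₁ (iter P m (entry F q))) (cong proj₁ at) (trans (ℕ.+-comm o k) k+o≡K)
        (subst (λ s → proj₁ (along-q k) ≼ proj₁ s) (iter-+ P o k (entry F q)) (cell-iter-≽ P o (along-q k)))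

module FlipNortheastmost {n : ℕ} (F : AltShape n) (P : PipeDream) (ω : Permutation′ n)
  (reduced : Reduced F P) (exits : HasExit F P ω) (p q : Fin n) (p<q : p Fin.< q)
  (π' π : Permutation′ n) (swap : AdjSwap p q π' π) (lin : LinExt (ContactArc F P) π)
  (arc : ContactArc F P q p) where

  open Pipes F P
  open NortheastmostContact.Chosen {ω = ω} exits p q arc
  open EarlierCross (crossing-before-contact p<q q-c p-c)
  open Flipping F P contact-c q-c p-c cross-x p-x q-x x-before-y

  cross-in : CrossIn F P q p x
  cross-in = cross-x , inj₂ (reaches⇒visits p-x , reaches⇒visits q-x)

  northeastmost : NEmostContact F P q p c
  northeastmost = (contact-c , inj₁ (reaches⇒visits q-c , reaches⇒visits p-c)) , bound
    where
    bound : ∀ c' → ContactBetween F P q p c' → c' ≼ c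
    bound c' (contact′ , inj₁ (q-c′ , p-c′)) =
      dominated contact′ (visits⇒reaches q-c′) (visits⇒reaches p-c′)
    bound c' (contact′ , inj₂ (p-c′ , q-c′)) =
      ⊥-elim (ℕ.<-asym (lin p q (c' , contact′ , p-c′ , q-c′)) (adjSwap-q-before-p {π' = π'} {π} swap))

  -- Every contact of q over p is crossed first at x, by reducedness, and lies southwest of c.
  qp-in-window : ∀ {y} → P y ≡ contact → Passes q (y , fromW) → Passes p (y , fromS) →
    Window (cellLevel y)
  qp-in-window {y} contact-y q-y p-y =
    subst (λ x′ → cellLevel x′ < cellLevel y) (reduced q p _ _ cross-in′ cross-in)
      (EarlierCross.x-before-y earlier) ,
    cellLevel-mono (dominated contact-y q-y p-y)
    where
    earlier : EarlierCross p q y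
    earlier = crossing-before-contact p<q q-y p-y
    cross-in′ : CrossIn F P q p (EarlierCross.x earlier)
    cross-in′ = EarlierCross.cross-x earlier ,
                inj₂ (reaches⇒visits (EarlierCross.p-x earlier) , reaches⇒visits (EarlierCross.q-x earlier))

  flipped : ∃[ c ] ∃[ x ] (NEmostContact F P q p c × CrossIn F P q p x × LinExt (ContactArc F (flip P c x)) π')
  flipped = c , x , northeastmost , cross-in , flipped-linExt {π'} {π} swap lin qp-in-window

lemma2p3 : ∀ {n} (F : AltShape n) (ω : Permutation′ n) → Sortable F ω →
    (P : PipeDream) → InΣ F ω P →
    (p q : Fin n) → p Fin.< q → (π' π : Permutation′ n) → AdjSwap p q π' π →
    LinExt (ContactArc F P) π →
    (¬ ContactArc F P q p → LinExt (ContactArc F P) π')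
    × (ContactArc F P q p →
        ∃[ c ] ∃[ x ] (NEmostContact F P q p c × CrossIn F P q p x
          × LinExt (ContactArc F (flip P c x)) π'))
lemma2p3 F ω _ P ((reduced , exits) , _) p q p<q π' π swap lin =
  (λ no-qp a b arc →
    adjSwap-order-kept {p = p} {q} {π'} {π} swap (lin a b arc) λ { (refl , refl) → no-qp arc }) ,
  FlipNortheastmost.flipped F P ω reduced exits p q p<q π' π swap lin
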